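{- Let $p$ and $m$ be positive integers. The binomial coefficients $\binom{\lambda p+1}{2}$ are divisible by $m$ for all non-negative integers $\lambda$ if and only if either $m$ is odd and $p$ is divisible by $m$, or $m$ is even and $p$ is divisible by $2m$. -}

module Defs where

{-# OPTIONS --safe #-}
-- Write T(n) = (n + 1) C 2 = n (n + 1) / 2. The identity 4 T(p) = T(2p) + p shows that m ∣ T(p)
-- and m ∣ T(2p) already force m ∣ p. For odd m that suffices, since m ∣ λp ∣ 2 T(λp) and m is
-- coprime to 2. For even m, writing p = q m gives 2 T(p) = (p + 1) q m with p + 1 odd, so
-- m ∣ T(p) forces q to be even; conversely 2m ∣ λp ∣ 2 T(λp) gives m ∣ T(λp).
module Submission where

open import Defs
open import Data.Nat using (ℕ; suc; _+_; _*_; _>_)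
open import Data.Nat.Divisibility using (_∣_)
open import Data.Nat.Combinatorics using (_C_)
open import Data.Product using (_×_)
open import Data.Sum using (_⊎_)
open import Relation.Nullary using (¬_)
open import Function.Bundles using (_⇔_)

open import Data.Nat using (zero)
open import Data.Nat.Properties using (*-distribˡ-+; *-cancelˡ-≡; *-identityˡ; *-assoc)
open import Data.Nat.Divisibility
  using (divides-refl; _∣?_; ∣-trans; ∣m+n∣m⇒∣n; ∣n⇒∣m*n; ∣1⇒≡1; 0∣⇒≡0;
         *-monoʳ-∣; *-monoˡ-∣; *-cancelˡ-∣; *-cancelʳ-∣)
open import Data.Nat.Combinatorics using (nC1≡n; nCk+nC[k+1]≡[n+1]C[k+1])
open import Data.Nat.Coprimality using (Coprime; coprime-divisor)
open import Data.Nat.Primality using (Prime; prime[2]; prime⇒irreducible; euclidsLemma)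
open import Data.Nat.Tactic.RingSolver using (solve-∀)
open import Data.Product using (_,_)
open import Data.Sum using (inj₁; inj₂)
open import Relation.Nullary using (yes; no; contradiction)
open import Relation.Binary.PropositionalEquality using (_≡_; refl; cong; sym; trans; subst; module ≡-Reasoning)
open import Function.Bundles using (mk⇔)

open ≡-Reasoning

2*[n+1]C2≡[n+1]*n : ∀ n → 2 * ((n + 1) C 2) ≡ (n + 1) * n
2*[n+1]C2≡[n+1]*n zero    = refl
2*[n+1]C2≡[n+1]*n (suc n) = begin
  2 * (suc (n + 1) C 2)           ≡⟨ cong (2 *_) (sym (nCk+nC[k+1]≡[n+1]C[k+1] (n + 1) 1)) ⟩
  2 * ((n + 1) C 1 + (n + 1) C 2) ≡⟨ cong (λ c → 2 * (c + (n + 1) C 2)) (nC1≡n (n + 1)) ⟩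
  2 * ((n + 1) + (n + 1) C 2)     ≡⟨ *-distribˡ-+ 2 (n + 1) ((n + 1) C 2) ⟩
  2 * (n + 1) + 2 * ((n + 1) C 2) ≡⟨ cong (2 * (n + 1) +_) (2*[n+1]C2≡[n+1]*n n) ⟩
  2 * (n + 1) + (n + 1) * n       ≡⟨ ring n ⟩
  (suc n + 1) * suc n             ∎
  where
  ring : ∀ n → 2 * (n + 1) + (n + 1) * n ≡ (suc n + 1) * suc n
  ring = solve-∀

4*[n+1]C2≡[2n+1]C2+n : ∀ n → 4 * ((n + 1) C 2) ≡ (2 * n + 1) C 2 + n
4*[n+1]C2≡[2n+1]C2+n n = *-cancelˡ-≡ _ _ 2 (begin
  2 * (4 * ((n + 1) C 2))           ≡⟨ ring₁ ((n + 1) C 2) ⟩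
  4 * (2 * ((n + 1) C 2))           ≡⟨ cong (4 *_) (2*[n+1]C2≡[n+1]*n n) ⟩
  4 * ((n + 1) * n)                 ≡⟨ ring₂ n ⟩
  (2 * n + 1) * (2 * n) + 2 * n     ≡⟨ cong (_+ 2 * n) (sym (2*[n+1]C2≡[n+1]*n (2 * n))) ⟩
  2 * ((2 * n + 1) C 2) + 2 * n     ≡⟨ sym (*-distribˡ-+ 2 ((2 * n + 1) C 2) n) ⟩
  2 * ((2 * n + 1) C 2 + n)         ∎)
  where
  ring₁ : ∀ t → 2 * (4 * t) ≡ 4 * (2 * t)
  ring₁ = solve-∀
  ring₂ : ∀ n → 4 * ((n + 1) * n) ≡ (2 * n + 1) * (2 * n) + 2 * n
  ring₂ = solve-∀

∣[n+1]C2∧∣[2n+1]C2⇒∣n : ∀ {d n} → d ∣ (n + 1) C 2 → d ∣ (2 * n + 1) C 2 → d ∣ n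
∣[n+1]C2∧∣[2n+1]C2⇒∣n {d} {n} d∣Tn d∣T2n =
  ∣m+n∣m⇒∣n (subst (d ∣_) (4*[n+1]C2≡[2n+1]C2+n n) (∣n⇒∣m*n 4 d∣Tn)) d∣T2n

∤prime⇒coprime : ∀ {p m} → Prime p → ¬ p ∣ m → Coprime m p
∤prime⇒coprime pp p∤m (d∣m , d∣p) with prime⇒irreducible pp d∣p
... | inj₁ d≡1 = d≡1
... | inj₂ refl = contradiction d∣m p∤m

odd∣⇒∣[n+1]C2 : ∀ {m n} → ¬ 2 ∣ m → m ∣ n → m ∣ (n + 1) C 2
odd∣⇒∣[n+1]C2 {m} {n} 2∤m m∣n = coprime-divisor (∤prime⇒coprime prime[2] 2∤m)
  (subst (m ∣_) (sym (2*[n+1]C2≡[n+1]*n n)) (∣n⇒∣m*n (n + 1) m∣n))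

2*∣⇒∣[n+1]C2 : ∀ {m n} → 2 * m ∣ n → m ∣ (n + 1) C 2
2*∣⇒∣[n+1]C2 {m} {n} 2m∣n =
  *-cancelˡ-∣ 2 (subst (2 * m ∣_) (sym (2*[n+1]C2≡[n+1]*n n)) (∣n⇒∣m*n (n + 1) 2m∣n))

even∣∧∣[n+1]C2⇒2*∣ : ∀ {m n} → 2 ∣ m → m ∣ n → m ∣ (n + 1) C 2 → 2 * m ∣ n
even∣∧∣[n+1]C2⇒2*∣ {zero} _ 0∣n _ rewrite 0∣⇒≡0 0∣n = divides-refl 0
even∣∧∣[n+1]C2⇒2*∣ {m@(suc _)} 2∣m m∣n@(divides-refl q) m∣Tn
  with euclidsLemma (q * m + 1) q prime[2] 2∣[n+1]*q
  where
  2T≡[n+1]*q*m : 2 * ((q * m + 1) C 2) ≡ (q * m + 1) * q * m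
  2T≡[n+1]*q*m = trans (2*[n+1]C2≡[n+1]*n (q * m)) (sym (*-assoc (q * m + 1) q m))
  2∣[n+1]*q : 2 ∣ (q * m + 1) * q
  2∣[n+1]*q = *-cancelʳ-∣ m (subst (2 * m ∣_) 2T≡[n+1]*q*m (*-monoʳ-∣ 2 m∣Tn))
... | inj₁ 2∣n+1 with () ← ∣1⇒≡1 (∣m+n∣m⇒∣n 2∣n+1 (∣-trans 2∣m m∣n))
... | inj₂ 2∣q = *-monoˡ-∣ m 2∣q

proposition13 : (p m : ℕ) → p > 0 → m > 0 →
    ((∀ (λ′ : ℕ) → m ∣ ((λ′ * p + 1) C 2)) ⇔
      (((¬ (2 ∣ m)) × (m ∣ p)) ⊎ ((2 ∣ m) × ((2 * m) ∣ p))))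
proposition13 p m _ _ = mk⇔ forward backward
  where
  m∣Tp : (∀ λ′ → m ∣ (λ′ * p + 1) C 2) → m ∣ (p + 1) C 2
  m∣Tp h = subst (λ x → m ∣ (x + 1) C 2) (*-identityˡ p) (h 1)

  m∣p : (∀ λ′ → m ∣ (λ′ * p + 1) C 2) → m ∣ p
  m∣p h = ∣[n+1]C2∧∣[2n+1]C2⇒∣n (m∣Tp h) (h 2)

  forward : (∀ λ′ → m ∣ (λ′ * p + 1) C 2) → (¬ 2 ∣ m × m ∣ p) ⊎ (2 ∣ m × 2 * m ∣ p)
  forward h with 2 ∣? m
  ... | no 2∤m  = inj₁ (2∤m , m∣p h)
  ... | yes 2∣m = inj₂ (2∣m , even∣∧∣[n+1]C2⇒2*∣ 2∣m (m∣p h) (m∣Tp h))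

  backward : (¬ 2 ∣ m × m ∣ p) ⊎ (2 ∣ m × 2 * m ∣ p) → ∀ λ′ → m ∣ (λ′ * p + 1) C 2
  backward (inj₁ (2∤m , m∣p)) λ′ = odd∣⇒∣[n+1]C2 2∤m (∣n⇒∣m*n λ′ m∣p)
  backward (inj₂ (_ , 2m∣p))  λ′ = 2*∣⇒∣[n+1]C2 (∣n⇒∣m*n λ′ 2m∣p)
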